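{- Let $q$ be a prime power, let $M$ be a simple rank-$r$ matroid representable over $GF(q)$, and let $w$ be a weight function on $M$. Suppose that $M\not\cong PG(r-1,q)$ and that $\frac{w(M)}{g^\ast(M)}=\frac{q}{q-1}$. Then $q^{r-1}w(e)\leq w(M)$ for all $e\in E(M)$.
   Context: A weight function on a simple matroid $M$ is a function $w:E(M)\to\mathbb{Z}_{>0}$; for $X\subseteq E(M)$, $w(X)=\sum_{x\in X}w(x)$ and $w(M)=w(E(M))$. The cogirth $g^\ast(M)$ of a weighted matroid is the minimum weight of a cocircuit of $M$. -}

module Defs where

open import Level using (0ℓ)
open import Algebra.Bundles using (CommutativeRing)
open import Data.Nat using (ℕ; zero; suc; _+_; _^_; _≤_)
open import Data.Nat.Primality using (Prime)
open import Data.Fin using (Fin)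
open import Data.Fin.Subset using (Subset; _∈_; _∉_; _⊆_; _∩_; Nonempty; ∣_∣)
open import Data.Vec using ([]; _∷_; tabulate; lookup)
open import Data.Bool using (if_then_else_)
open import Data.Product using (Σ; ∃; ∃₂; _×_)
open import Function using (_∘_)
open import Function.Bundles using (_⤖_; Bijection)
open import Relation.Nullary using (¬_)
open import Relation.Binary.PropositionalEquality using (_≡_)

IsPrimePower : ℕ → Set
IsPrimePower q = ∃₂ λ p k → Prime p × q ≡ p ^ suc k

record IsFiniteField (R : CommutativeRing 0ℓ 0ℓ) (q : ℕ) : Set where
  open CommutativeRing R
  field
    1≉0        : ¬ (1# ≈ 0#)
    inverse    : ∀ x → ¬ (x ≈ 0#) → ∃ λ y → x * y ≈ 1#
    toFin      : Carrier → Fin q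
    fromFin    : Fin q → Carrier
    toFin-cong : ∀ {x y} → x ≈ y → toFin x ≡ toFin y
    to-from    : ∀ i → toFin (fromFin i) ≡ i
    from-to    : ∀ x → fromFin (toFin x) ≈ x

wt : ∀ {n} → (Fin n → ℕ) → Subset n → ℕ
wt w []      = 0
wt w (b ∷ X) = (if b then w Fin.zero else 0) + wt (w ∘ Fin.suc) X

-- A matroid on E = Fin n represented over R is given by v : Fin n → R^k
-- (column vectors of a representing matrix); X ⊆ E is independent iff the
-- family (v i)_{i ∈ X} is linearly independent.
module _ (R : CommutativeRing 0ℓ 0ℓ) where
  open CommutativeRing R
  open import Algebra.Definitions.RawMonoid +-rawMonoid using (sum)

  Indep : ∀ {n k} → (Fin n → Fin k → Carrier) → Subset n → Set
  Indep {n} {k} v X =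
    ∀ (c : Fin n → Carrier) → (∀ i → i ∉ X → c i ≈ 0#) →
    (∀ (j : Fin k) → sum (λ i → c i * v i j) ≈ 0#) → ∀ i → c i ≈ 0#

  HasRank : ∀ {n k} → (Fin n → Fin k → Carrier) → ℕ → Set
  HasRank v r = (∃ λ X → Indep v X × ∣ X ∣ ≡ r) × (∀ X → Indep v X → ∣ X ∣ ≤ r)

  Simple : ∀ {n k} → (Fin n → Fin k → Carrier) → Set
  Simple v = ∀ X → ∣ X ∣ ≤ 2 → Indep v X

  IsBasis : ∀ {n k} → (Fin n → Fin k → Carrier) → Subset n → Set
  IsBasis v B = Indep v B × (∀ Y → B ⊆ Y → Indep v Y → Y ≡ B)

  MeetsAllBases : ∀ {n k} → (Fin n → Fin k → Carrier) → Subset n → Set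
  MeetsAllBases v C = ∀ B → IsBasis v B → Nonempty (B ∩ C)

  IsCocircuit : ∀ {n k} → (Fin n → Fin k → Carrier) → Subset n → Set
  IsCocircuit v C = MeetsAllBases v C × (∀ D → D ⊆ C → MeetsAllBases v D → D ≡ C)

  -- u : Fin m → R^r lists exactly one representative of each 1-dimensional
  -- subspace of R^r; the matroid it represents is PG(r-1,q) when |R| = q.
  IsPGRep : ∀ {m} (r : ℕ) → (Fin m → Fin r → Carrier) → Set
  IsPGRep {m} r u =
    (∀ i → ¬ (∀ j → u i j ≈ 0#)) ×
    (∀ (x : Fin r → Carrier) → ¬ (∀ j → x j ≈ 0#) →
       ∃₂ λ i a → ∀ j → x j ≈ a * u i j) ×
    (∀ i i' a → (∀ j → u i j ≈ a * u i' j) → i ≡ i')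

  Isomorphic : ∀ {n k m l} → (Fin n → Fin k → Carrier) → (Fin m → Fin l → Carrier) → Set
  Isomorphic {n} {k} {m} {l} v u =
    Σ (Fin n ⤖ Fin m) λ f →
      ∀ (Y : Subset m) →
        let X = tabulate (λ i → lookup Y (Bijection.to f i)) in
        (Indep u Y → Indep v X) × (Indep v X → Indep u Y)

  IsoToPG : ∀ {n k} → (Fin n → Fin k → Carrier) → ℕ → Set
  IsoToPG v r = ∃₂ λ m (u : Fin m → Fin r → Carrier) → IsPGRep r u × Isomorphic v u

-- Fix e and a basis B = D ∪ {e}, and let A g be the coordinates of g in B.  Every
-- c ∈ GF(q)^D gives the linear functional φ_c(g) = Σ_h c_h (A g)_h on M.  For c ≠ 0 its
-- support (the complement of a hyperplane) meets every basis, so it contains a cocircuit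
-- and weighs at least g*.  Counting the pairs (c, g) with φ_c(g) ≠ 0: there are none with
-- g = e, and for g ≠ e (whose coordinates on D are nonzero because M is simple) there are
-- exactly (q - 1) q^(r-2).  Hence
--   (q - 1) q^(r-2) (w(M) - w(e)) = Σ_c w(supp φ_c) ≥ (q^(r-1) - 1) g*,
-- and q g* = (q - 1) w(M) turns this into q^(r-1) w(e) ≤ w(M).
-- Independence is not given as decidable, so the classical steps are made in the
-- double-negation monad and the decidable conclusion is recovered at the end.

module Submission where

open import Defs
open import Level using (0ℓ)
open import Algebra.Bundles using (CommutativeRing)
open import Data.Nat using (ℕ; _*_; _∸_; _^_; _≤_)
open import Data.Fin using (Fin)
open import Data.Fin.Subset using (⊤)
open import Data.Product using (∃; _×_)
open import Relation.Nullary using (¬_)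
open import Relation.Binary.PropositionalEquality using (_≡_)

open import Data.Nat using (zero; suc; _+_; _≤?_; z≤n; s≤s)
import Data.Nat.Properties as ℕₚ
open import Algebra.Properties.CommutativeMonoid.Sum ℕₚ.+-0-commutativeMonoid
  using () renaming (sum to ∑ℕ; sum-cong-≗ to ∑ℕ-cong; ∑-distrib-+ to ∑ℕ-distrib-+)
open import Algebra.Properties.CommutativeSemigroup ℕₚ.+-commutativeSemigroup
  using () renaming (xy∙z≈xz∙y to x+y+z≡x+z+y)
open import Algebra.Properties.CommutativeSemigroup ℕₚ.*-commutativeSemigroup
  using (x∙yz≈y∙xz; xy∙z≈y∙xz)
open import Algebra.Properties.Semiring.Sum ℕₚ.+-*-semiring
  using () renaming (*-distribˡ-sum to *-distribˡ-∑ℕ)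
open import Data.Bool using (Bool; true; if_then_else_)
open import Data.Fin using (zero; suc; punchIn)
open import Data.Fin.Properties using (_≟_; any?; ¬Fin0; suc-injective; 0≢1+n; punchInᵢ≢i)
open import Data.Fin.Subset using (Subset; _∈_; _∉_; _⊆_; _∩_; ∣_∣; ⁅_⁆; Nonempty; inside; outside)
open import Data.Fin.Subset.Properties
  using (_∈?_; drop-there; x∈⁅x⁆; ∣⁅x⁆∣≡1; ∣p∣≤n; x∈p∩q⁺; x∈p∩q⁻; nonempty?; ⊆-refl; ⊆-antisym)
open import Data.Product using (_,_; proj₁; proj₂)
open import Data.Sum using (_⊎_; inj₁; inj₂)
open import Data.Vec using ([]; _∷_; here; there; tabulate; _[_]≔_)
import Data.Vec.Functional as V
import Data.Vec.Properties as Vecₚ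
open import Effect.Monad using (RawMonad)
open import Function using (_∘_; id)
open import Relation.Binary.PropositionalEquality
  using (_≢_; refl; sym; trans; cong; cong₂; subst; module ≡-Reasoning)
import Relation.Binary.Reasoning.Setoid
open import Relation.Nullary using (Dec; yes; no; does)
open import Relation.Nullary.Decidable
  using (¬?; _×-dec_; decidable-stable; ¬¬-excluded-middle; dec-true)
open import Relation.Nullary.Negation using (¬¬-Monad; contradiction)

open RawMonad (¬¬-Monad {0ℓ}) using (pure; _>>=_)

¬¬-pull-Fin : ∀ {n} {P : Fin n → Set} → (∀ i → ¬ ¬ P i) → ¬ ¬ (∀ i → P i)
¬¬-pull-Fin {zero}  f k = k (λ ())
¬¬-pull-Fin {suc n} f k =
  f zero λ p₀ → ¬¬-pull-Fin (f ∘ suc) λ ps → k λ { zero → p₀ ; (suc i) → ps i }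

-- Finite sums of natural numbers

𝟙 : ∀ {A : Set} → Dec A → ℕ
𝟙 (yes _) = 1
𝟙 (no _)  = 0

𝟙-yes : ∀ {A : Set} (a? : Dec A) → A → 𝟙 a? ≡ 1
𝟙-yes (yes _) _ = refl
𝟙-yes (no ¬a) a = contradiction a ¬a

𝟙-no : ∀ {A : Set} (a? : Dec A) → ¬ A → 𝟙 a? ≡ 0
𝟙-no (yes a) ¬a = contradiction a ¬a
𝟙-no (no _)  _  = refl

𝟙-cong : ∀ {A B : Set} → (A → B) → (B → A) → (a? : Dec A) (b? : Dec B) → 𝟙 a? ≡ 𝟙 b?
𝟙-cong f g (yes a) (yes b) = refl
𝟙-cong f g (yes a) (no ¬b) = contradiction (f a) ¬b
𝟙-cong f g (no ¬a) (yes b) = contradiction (g b) ¬a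
𝟙-cong f g (no ¬a) (no ¬b) = refl

𝟙-¬ : ∀ {A : Set} (a? : Dec A) → 𝟙 (¬? a?) + 𝟙 a? ≡ 1
𝟙-¬ (yes _) = refl
𝟙-¬ (no _)  = refl

∑ℕ-const : ∀ {m} k → ∑ℕ {m} (λ _ → k) ≡ m * k
∑ℕ-const {zero}  k = refl
∑ℕ-const {suc m} k = cong (k +_) (∑ℕ-const {m} k)

∑ℕ-mono : ∀ {m} {f g : Fin m → ℕ} → (∀ i → f i ≤ g i) → ∑ℕ f ≤ ∑ℕ g
∑ℕ-mono {zero}  f≤g = z≤n
∑ℕ-mono {suc m} f≤g = ℕₚ.+-mono-≤ (f≤g zero) (∑ℕ-mono (f≤g ∘ suc))

∑ℕ-𝟙-unique : ∀ {m} {P : Fin m → Set} (P? : ∀ i → Dec (P i)) i₀ →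
  P i₀ → (∀ i → P i → i ≡ i₀) → ∑ℕ (λ i → 𝟙 (P? i)) ≡ 1
∑ℕ-𝟙-unique {suc m} P? zero p unique = cong₂ _+_ (𝟙-yes (P? zero) p) (begin
  ∑ℕ (λ i → 𝟙 (P? (suc i))) ≡⟨ ∑ℕ-cong (λ i → 𝟙-no (P? (suc i)) (λ p → 0≢1+n (sym (unique _ p)))) ⟩
  ∑ℕ {m} (λ i → 0)           ≡⟨ ∑ℕ-const {m} 0 ⟩
  m * 0                      ≡⟨ ℕₚ.*-zeroʳ m ⟩
  0                          ∎)
  where open ≡-Reasoning
∑ℕ-𝟙-unique P? (suc i₀) p unique =
  cong₂ _+_ (𝟙-no (P? zero) (λ p₀ → 0≢1+n (unique zero p₀)))
            (∑ℕ-𝟙-unique (P? ∘ suc) i₀ p (λ i pᵢ → suc-injective (unique (suc i) pᵢ)))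

∑ℕ-*-except : ∀ {m} (w f : Fin m → ℕ) e K → f e ≡ 0 → (∀ i → i ≢ e → f i ≡ K) →
  ∑ℕ (λ i → w i * f i) + K * w e ≡ K * ∑ℕ w
∑ℕ-*-except w f zero K fₑ≡0 f≡K = begin
  w zero * f zero + S + K * w zero ≡⟨ cong (λ x → w zero * x + S + K * w zero) fₑ≡0 ⟩
  w zero * 0 + S + K * w zero      ≡⟨ cong (λ x → x + S + K * w zero) (ℕₚ.*-zeroʳ (w zero)) ⟩
  S + K * w zero                   ≡⟨ ℕₚ.+-comm S _ ⟩
  K * w zero + S                   ≡⟨ cong (K * w zero +_) S≡ ⟩
  K * w zero + K * ∑ℕ (w ∘ suc)    ≡⟨ ℕₚ.*-distribˡ-+ K _ _ ⟨
  K * ∑ℕ w                         ∎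
  where
  open ≡-Reasoning
  S = ∑ℕ (λ i → w (suc i) * f (suc i))
  S≡ : S ≡ K * ∑ℕ (w ∘ suc)
  S≡ = trans (∑ℕ-cong (λ i → trans (cong (w (suc i) *_) (f≡K (suc i) λ ())) (ℕₚ.*-comm _ K)))
             (sym (*-distribˡ-∑ℕ K (w ∘ suc)))
∑ℕ-*-except w f (suc e) K fₑ≡0 f≡K = begin
  w zero * f zero + S + K * w (suc e)   ≡⟨ ℕₚ.+-assoc (w zero * f zero) S _ ⟩
  w zero * f zero + (S + K * w (suc e)) ≡⟨ cong₂ _+_ head tail ⟩
  K * w zero + K * ∑ℕ (w ∘ suc)         ≡⟨ ℕₚ.*-distribˡ-+ K _ _ ⟨
  K * ∑ℕ w                              ∎
  where
  open ≡-Reasoning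
  S = ∑ℕ (λ i → w (suc i) * f (suc i))
  head = trans (cong (w zero *_) (f≡K zero λ ())) (ℕₚ.*-comm (w zero) K)
  tail = ∑ℕ-*-except (w ∘ suc) (f ∘ suc) e K fₑ≡0 (λ i i≢e → f≡K (suc i) (i≢e ∘ suc-injective))

-- Updating one element of a subset

module _ {m : ℕ} where

  ∈-[]≔⁺ : ∀ (p : Subset m) {x y} b → y ≢ x → y ∈ p → y ∈ p [ x ]≔ b
  ∈-[]≔⁺ p b y≢x = Vecₚ.[]≔-minimal p _ _ y≢x

  ∈-[]≔⁻ : ∀ (p : Subset m) {x y} b → y ≢ x → y ∈ p [ x ]≔ b → y ∈ p
  ∈-[]≔⁻ p {x} {y} b y≢x y∈ = Vecₚ.lookup⇒[]= y p
    (trans (sym (Vecₚ.lookup∘updateAt′ y x y≢x p)) (Vecₚ.[]=⇒lookup y∈))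

  x∈p[x]≔inside : ∀ (p : Subset m) x → x ∈ p [ x ]≔ inside
  x∈p[x]≔inside = Vecₚ.[]≔-updates

  x∉p[x]≔outside : ∀ (p : Subset m) x → x ∉ p [ x ]≔ outside
  x∉p[x]≔outside p x x∈ = contradiction (Vecₚ.[]=-injective x∈ (Vecₚ.[]≔-updates p x)) λ ()

  ∈-[]≔inside⁻ : ∀ (p : Subset m) x {y} → y ∈ p [ x ]≔ inside → y ≡ x ⊎ y ∈ p
  ∈-[]≔inside⁻ p x {y} y∈ with y ≟ x
  ... | yes y≡x = inj₁ y≡x
  ... | no  y≢x = inj₂ (∈-[]≔⁻ p inside y≢x y∈)

  p⊆p[x]≔inside : ∀ (p : Subset m) x → p ⊆ p [ x ]≔ inside
  p⊆p[x]≔inside p x {y} y∈ with y ≟ x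
  ... | yes refl = x∈p[x]≔inside p x
  ... | no  y≢x  = ∈-[]≔⁺ p inside y≢x y∈

  p[x]≔outside⊆p : ∀ (p : Subset m) x → p [ x ]≔ outside ⊆ p
  p[x]≔outside⊆p p x {y} y∈ with y ≟ x
  ... | yes refl = contradiction y∈ (x∉p[x]≔outside p x)
  ... | no  y≢x  = ∈-[]≔⁻ p outside y≢x y∈

  ∈-tabulate⁺ : ∀ (f : Fin m → Bool) {x} → f x ≡ true → x ∈ tabulate f
  ∈-tabulate⁺ f {x} fx = Vecₚ.lookup⇒[]= x (tabulate f) (trans (Vecₚ.lookup∘tabulate f x) fx)

∣p[x]≔inside∣ : ∀ {m} (p : Subset m) x → x ∉ p → ∣ p [ x ]≔ inside ∣ ≡ suc ∣ p ∣
∣p[x]≔inside∣ (inside  ∷ p) zero    x∉ = contradiction here x∉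
∣p[x]≔inside∣ (outside ∷ p) zero    x∉ = refl
∣p[x]≔inside∣ (inside  ∷ p) (suc x) x∉ = cong suc (∣p[x]≔inside∣ p x (x∉ ∘ there))
∣p[x]≔inside∣ (outside ∷ p) (suc x) x∉ = ∣p[x]≔inside∣ p x (x∉ ∘ there)

∣p[x]≔inside∣≤ : ∀ {m} (p : Subset m) x → ∣ p [ x ]≔ inside ∣ ≤ suc ∣ p ∣
∣p[x]≔inside∣≤ (inside  ∷ p) zero    = ℕₚ.n≤1+n _
∣p[x]≔inside∣≤ (outside ∷ p) zero    = ℕₚ.≤-refl
∣p[x]≔inside∣≤ (inside  ∷ p) (suc x) = s≤s (∣p[x]≔inside∣≤ p x)
∣p[x]≔inside∣≤ (outside ∷ p) (suc x) = ∣p[x]≔inside∣≤ p x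

∣p[x]≔outside∣ : ∀ {m} (p : Subset m) x → x ∈ p → suc ∣ p [ x ]≔ outside ∣ ≡ ∣ p ∣
∣p[x]≔outside∣ (inside  ∷ p) zero    _         = refl
∣p[x]≔outside∣ (inside  ∷ p) (suc x) (there x∈) = cong suc (∣p[x]≔outside∣ p x x∈)
∣p[x]≔outside∣ (outside ∷ p) (suc x) (there x∈) = ∣p[x]≔outside∣ p x x∈

wt-⊤ : ∀ {m} (w : Fin m → ℕ) → wt w ⊤ ≡ ∑ℕ w
wt-⊤ {zero}  w = refl
wt-⊤ {suc m} w = cong (w zero +_) (wt-⊤ (w ∘ suc))

wt-tabulate : ∀ {m} (w : Fin m → ℕ) {P : Fin m → Set} (P? : ∀ i → Dec (P i)) →
  wt w (tabulate (does ∘ P?)) ≡ ∑ℕ (λ i → w i * 𝟙 (P? i))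
wt-tabulate {zero}  w P? = refl
wt-tabulate {suc m} w P? = cong₂ _+_ (head (P? zero)) (wt-tabulate (w ∘ suc) (P? ∘ suc))
  where
  head : ∀ {A : Set} (a? : Dec A) → (if does a? then w zero else 0) ≡ w zero * 𝟙 a?
  head (yes _) = sym (ℕₚ.*-identityʳ (w zero))
  head (no _)  = sym (ℕₚ.*-zeroʳ (w zero))

wt-mono : ∀ {m} (w : Fin m → ℕ) {X Y : Subset m} → X ⊆ Y → wt w X ≤ wt w Y
wt-mono w {[]}          {[]}          X⊆Y = z≤n
wt-mono w {inside ∷ X}  {inside ∷ Y}  X⊆Y =
  ℕₚ.+-monoʳ-≤ (w zero) (wt-mono (w ∘ suc) (λ x∈ → drop-there (X⊆Y (there x∈))))
wt-mono w {inside ∷ X}  {outside ∷ Y} X⊆Y = contradiction (X⊆Y here) λ ()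
wt-mono w {outside ∷ X} {b ∷ Y}       X⊆Y = ℕₚ.≤-trans
  (wt-mono (w ∘ suc) (λ x∈ → drop-there (X⊆Y (there x∈)))) (ℕₚ.m≤n+m _ _)

-- Cocircuits

module Cocircuits {R : CommutativeRing 0ℓ 0ℓ} {n k} (v : Fin n → Fin k → CommutativeRing.Carrier R) where

  MeetsAllBases-mono : ∀ {X Y} → X ⊆ Y → MeetsAllBases R v X → MeetsAllBases R v Y
  MeetsAllBases-mono {X} X⊆Y meets B B-basis with meets B B-basis
  ... | x , x∈B∩X = x , x∈p∩q⁺ (proj₁ (x∈p∩q⁻ B X x∈B∩X) , X⊆Y (proj₂ (x∈p∩q⁻ B X x∈B∩X)))

  Shrinkable : Subset n → Set
  Shrinkable S = ∃ λ x → x ∈ S × MeetsAllBases R v (S [ x ]≔ outside)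

  unshrinkable⇒IsCocircuit : ∀ {S} → MeetsAllBases R v S → ¬ Shrinkable S → IsCocircuit R v S
  unshrinkable⇒IsCocircuit {S} meets ¬shrinkable = meets , minimal
    where
    minimal : ∀ D → D ⊆ S → MeetsAllBases R v D → D ≡ S
    minimal D D⊆S meetsD with any? (λ x → x ∈? S ×-dec ¬? (x ∈? D))
    ... | yes (x , x∈S , x∉D) = contradiction (x , x∈S , MeetsAllBases-mono D⊆S-x meetsD) ¬shrinkable
      where
      D⊆S-x : D ⊆ S [ x ]≔ outside
      D⊆S-x {y} y∈D = ∈-[]≔⁺ S outside (λ { refl → x∉D y∈D }) (D⊆S y∈D)
    ... | no  ∄ = ⊆-antisym D⊆S λ {x} x∈S → decidable-stable (x ∈? D) λ x∉D → ∄ (x , x∈S , x∉D)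

  CocircuitWithin : Subset n → Set
  CocircuitWithin S = ∃ λ C → IsCocircuit R v C × C ⊆ S

  cocircuit-within : ∀ m {S} → ∣ S ∣ ≤ m → MeetsAllBases R v S → ¬ ¬ CocircuitWithin S
  cocircuit-within m {S} ∣S∣≤m meets = ¬¬-excluded-middle >>= shrink-or-stop m ∣S∣≤m
    where
    shrink-or-stop : ∀ m → ∣ S ∣ ≤ m → Dec (Shrinkable S) → ¬ ¬ CocircuitWithin S
    shrink-or-stop _ _ (no ¬shrinkable) = pure {A = CocircuitWithin S} (S , unshrinkable⇒IsCocircuit meets ¬shrinkable , ⊆-refl)
    shrink-or-stop zero ∣S∣≤0 (yes (x , x∈S , _)) =
      contradiction (subst (_≤ 0) (sym (∣p[x]≔outside∣ S x x∈S)) ∣S∣≤0) λ ()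
    shrink-or-stop (suc m) ∣S∣≤1+m (yes (x , x∈S , meets′)) =
      cocircuit-within m (ℕₚ.≤-pred (subst (_≤ suc m) (sym (∣p[x]≔outside∣ S x x∈S)) ∣S∣≤1+m)) meets′
        >>= λ (C , C-cocircuit , C⊆S-x) → pure {A = CocircuitWithin S}
          (C , C-cocircuit , λ y∈C → p[x]≔outside⊆p S x (C⊆S-x y∈C))

  MeetsAllBases⇒¬¬CocircuitWithin : ∀ {S} → MeetsAllBases R v S → ¬ ¬ CocircuitWithin S
  MeetsAllBases⇒¬¬CocircuitWithin {S} = cocircuit-within n (∣p∣≤n S)

field-size-2+ : ∀ {q} {R : CommutativeRing 0ℓ 0ℓ} → IsFiniteField R q → ∃ λ p → q ≡ suc (suc p)
field-size-2+ {zero} {R} F = contradiction (IsFiniteField.toFin F (CommutativeRing.0# R)) ¬Fin0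
field-size-2+ {suc zero} {R} F = contradiction (begin
  1#                 ≈⟨ from-to 1# ⟨
  fromFin (toFin 1#) ≡⟨ cong fromFin (trans (Fin1 (toFin 1#)) (sym (Fin1 (toFin 0#)))) ⟩
  fromFin (toFin 0#) ≈⟨ from-to 0# ⟩
  0#                 ∎) 1≉0
  where
  open CommutativeRing R using (0#; 1#; setoid)
  open IsFiniteField F
  open Relation.Binary.Reasoning.Setoid setoid
  Fin1 : (i : Fin 1) → i ≡ zero
  Fin1 zero = refl
field-size-2+ {suc (suc p)} F = p , refl

module FiniteField {q : ℕ} {R : CommutativeRing 0ℓ 0ℓ} (F : IsFiniteField R q) where

  open CommutativeRing R
    renaming (Carrier to K; _+_ to _⊕_; _*_ to _⊙_; -_ to ⊖_;
              refl to ≈-refl; sym to ≈-sym; trans to ≈-trans)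
    hiding (zero)
  open IsFiniteField F
  open import Algebra.Properties.Ring ring using (-1*x≈-x; -‿distribˡ-*; x∙y⁻¹≈ε⇒x≈y; \\-leftDividesˡ; \\-leftDividesʳ)
  open import Algebra.Properties.CommutativeMonoid.Sum +-commutativeMonoid
    using (sum; sum-cong-≋; sum-replicate-zero; sum-remove; ∑-distrib-+; ∑-comm)
  open import Algebra.Properties.Semiring.Sum semiring using (*-distribˡ-sum)
  module ≈-Reasoning = Relation.Binary.Reasoning.Setoid setoid

  infix 4 _≈?_
  _≈?_ : ∀ x y → Dec (x ≈ y)
  x ≈? y with toFin x ≟ toFin y
  ... | yes eq = yes (begin
    x                ≈⟨ from-to x ⟨
    fromFin (toFin x) ≡⟨ cong fromFin eq ⟩
    fromFin (toFin y) ≈⟨ from-to y ⟩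
    y                ∎)
    where open ≈-Reasoning
  ... | no  ne = no (ne ∘ toFin-cong)


  x≉0∧y≉0⇒x*y≉0 : ∀ {x y} → x ≉ 0# → y ≉ 0# → x ⊙ y ≉ 0#
  x≉0∧y≉0⇒x*y≉0 {x} {y} x≉0 y≉0 xy≈0 with inverse x x≉0
  ... | x⁻¹ , xx⁻¹≈1 = y≉0 (begin
    y             ≈⟨ *-identityˡ y ⟨
    1# ⊙ y        ≈⟨ *-congʳ (≈-trans (*-comm x⁻¹ x) xx⁻¹≈1) ⟨
    (x⁻¹ ⊙ x) ⊙ y ≈⟨ *-assoc x⁻¹ x y ⟩
    x⁻¹ ⊙ (x ⊙ y) ≈⟨ *-congˡ xy≈0 ⟩
    x⁻¹ ⊙ 0#      ≈⟨ zeroʳ x⁻¹ ⟩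
    0#            ∎)
    where open ≈-Reasoning

  x*y≈0∧y≉0⇒x≈0 : ∀ {x y} → x ⊙ y ≈ 0# → y ≉ 0# → x ≈ 0#
  x*y≈0∧y≉0⇒x≈0 {x} xy≈0 y≉0 =
    decidable-stable (x ≈? 0#) λ x≉0 → x≉0∧y≉0⇒x*y≉0 x≉0 y≉0 xy≈0

  sum-zero : ∀ {m} {f : Fin m → K} → (∀ i → f i ≈ 0#) → sum f ≈ 0#
  sum-zero {m} f≈0 = ≈-trans (sum-cong-≋ f≈0) (sum-replicate-zero m)

  sum-concentrated : ∀ {m} {f : Fin m → K} i → (∀ j → j ≢ i → f j ≈ 0#) → sum f ≈ f i
  sum-concentrated {suc m} {f} i f≈0 = begin
    sum f                        ≈⟨ sum-remove f ⟩
    f i ⊕ sum (f ∘ punchIn i)    ≈⟨ +-congˡ (sum-zero λ j → f≈0 _ (punchInᵢ≢i i j)) ⟩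
    f i ⊕ 0#                     ≈⟨ +-identityʳ (f i) ⟩
    f i                          ∎
    where open ≈-Reasoning

  δ : ∀ {m} → Fin m → Fin m → K
  δ i j = if does (j ≟ i) then 1# else 0#

  δ-diag : ∀ {m} (i : Fin m) → δ i i ≈ 1#
  δ-diag i with i ≟ i
  ... | yes _  = ≈-refl
  ... | no i≢i = contradiction refl i≢i

  δ-off : ∀ {m} {i j : Fin m} → j ≢ i → δ i j ≈ 0#
  δ-off {i = i} {j} j≢i with j ≟ i
  ... | yes j≡i = contradiction j≡i j≢i
  ... | no _    = ≈-refl

  ∑-δ : ∀ {m} (i : Fin m) (u : Fin m → K) → sum (λ j → δ i j ⊙ u j) ≈ u i
  ∑-δ i u = ≈-trans (sum-concentrated i λ j j≢i → ≈-trans (*-congʳ (δ-off j≢i)) (zeroˡ (u j)))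
                    (≈-trans (*-congʳ (δ-diag i)) (*-identityˡ (u i)))

  ∑-axpy : ∀ {m} (a b u : Fin m → K) s →
    sum {m} (λ h → (a h ⊕ s ⊙ b h) ⊙ u h) ≈ sum {m} (λ h → a h ⊙ u h) ⊕ s ⊙ sum {m} (λ h → b h ⊙ u h)
  ∑-axpy {m} a b u s = begin
    sum {m} (λ h → (a h ⊕ s ⊙ b h) ⊙ u h)
      ≈⟨ sum-cong-≋ (λ h → ≈-trans (distribʳ (u h) (a h) (s ⊙ b h)) (+-congˡ (*-assoc s (b h) (u h)))) ⟩
    sum {m} (λ h → a h ⊙ u h ⊕ s ⊙ (b h ⊙ u h))
      ≈⟨ ∑-distrib-+ (λ h → a h ⊙ u h) (λ h → s ⊙ (b h ⊙ u h)) ⟩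
    sum {m} (λ h → a h ⊙ u h) ⊕ sum {m} (λ h → s ⊙ (b h ⊙ u h))
      ≈⟨ +-congˡ (*-distribˡ-sum s (λ h → b h ⊙ u h)) ⟨
    sum {m} (λ h → a h ⊙ u h) ⊕ s ⊙ sum {m} (λ h → b h ⊙ u h) ∎
    where open ≈-Reasoning

  ∑∑-assoc : ∀ {l m} (d : Fin l → K) (M : Fin l → Fin m → K) (u : Fin m → K) →
    sum {m} (λ h → sum {l} (λ g → d g ⊙ M g h) ⊙ u h) ≈ sum {l} (λ g → d g ⊙ sum {m} (λ h → M g h ⊙ u h))
  ∑∑-assoc {l} {m} d M u = begin
    sum {m} (λ h → sum {l} (λ g → d g ⊙ M g h) ⊙ u h)
      ≈⟨ sum-cong-≋ (λ h → ≈-trans (*-comm _ (u h)) (*-distribˡ-sum (u h) (λ g → d g ⊙ M g h))) ⟩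
    sum {m} (λ h → sum {l} (λ g → u h ⊙ (d g ⊙ M g h)))
      ≈⟨ sum-cong-≋ (λ h → sum-cong-≋ λ g → ≈-trans (*-comm (u h) _) (*-assoc (d g) (M g h) (u h))) ⟩
    sum {m} (λ h → sum {l} (λ g → d g ⊙ (M g h ⊙ u h)))
      ≈⟨ ∑-comm {m} {l} (λ h g → d g ⊙ (M g h ⊙ u h)) ⟩
    sum {l} (λ g → sum {m} (λ h → d g ⊙ (M g h ⊙ u h)))
      ≈⟨ sum-cong-≋ (λ g → *-distribˡ-sum (d g) (λ h → M g h ⊙ u h)) ⟨
    sum {l} (λ g → d g ⊙ sum {m} (λ h → M g h ⊙ u h)) ∎
    where open ≈-Reasoning

  -- Counting vectors over the field

  Supported : ∀ {m} → Subset m → (Fin m → K) → Set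
  Supported S c = ∀ h → h ∉ S → c h ≈ 0#

  Supported-∷inside : ∀ {m} {S : Subset m} {c} x → Supported S c → Supported (inside ∷ S) (x V.∷ c)
  Supported-∷inside x c≈0 zero    0∉ = contradiction here 0∉
  Supported-∷inside x c≈0 (suc h) h∉ = c≈0 h (h∉ ∘ there)

  Supported-∷outside : ∀ {m} {S : Subset m} {c} → Supported S c → Supported (outside ∷ S) (0# V.∷ c)
  Supported-∷outside c≈0 zero    _  = ≈-refl
  Supported-∷outside c≈0 (suc h) h∉ = c≈0 h (h∉ ∘ there)

  -- The sum of F over the q ^ ∣ S ∣ vectors supported in S, with K enumerated by fromFin.
  ∑ᵥ : ∀ {m} → Subset m → ((Fin m → K) → ℕ) → ℕ
  ∑ᵥ []            F = F (λ ())
  ∑ᵥ (inside ∷ S)  F = ∑ℕ {q} λ t → ∑ᵥ S (F ∘ (fromFin t V.∷_))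
  ∑ᵥ (outside ∷ S) F = ∑ᵥ S (F ∘ (0# V.∷_))

  ∑ᵥ-cong : ∀ {m} (S : Subset m) {F G : (Fin m → K) → ℕ} →
    (∀ c → Supported S c → F c ≡ G c) → ∑ᵥ S F ≡ ∑ᵥ S G
  ∑ᵥ-cong []            F≡G = F≡G (λ ()) (λ ())
  ∑ᵥ-cong (inside ∷ S)  F≡G = ∑ℕ-cong {q} λ t →
    ∑ᵥ-cong S λ c c≈0 → F≡G _ (Supported-∷inside (fromFin t) c≈0)
  ∑ᵥ-cong (outside ∷ S) F≡G = ∑ᵥ-cong S λ c c≈0 → F≡G _ (Supported-∷outside c≈0)

  ∑ᵥ-mono : ∀ {m} (S : Subset m) {F G : (Fin m → K) → ℕ} →
    (∀ c → Supported S c → F c ≤ G c) → ∑ᵥ S F ≤ ∑ᵥ S G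
  ∑ᵥ-mono []            F≤G = F≤G (λ ()) (λ ())
  ∑ᵥ-mono (inside ∷ S)  F≤G = ∑ℕ-mono λ t →
    ∑ᵥ-mono S λ c c≈0 → F≤G _ (Supported-∷inside (fromFin t) c≈0)
  ∑ᵥ-mono (outside ∷ S) F≤G = ∑ᵥ-mono S λ c c≈0 → F≤G _ (Supported-∷outside c≈0)

  ∑ᵥ-distrib-+ : ∀ {m} (S : Subset m) (F G : (Fin m → K) → ℕ) →
    ∑ᵥ S (λ c → F c + G c) ≡ ∑ᵥ S F + ∑ᵥ S G
  ∑ᵥ-distrib-+ []            F G = refl
  ∑ᵥ-distrib-+ (inside ∷ S)  F G = trans (∑ℕ-cong {q} λ t → ∑ᵥ-distrib-+ S _ _) (∑ℕ-distrib-+ {q} _ _)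
  ∑ᵥ-distrib-+ (outside ∷ S) F G = ∑ᵥ-distrib-+ S _ _

  *-distribˡ-∑ᵥ : ∀ {m} (S : Subset m) k (F : (Fin m → K) → ℕ) →
    k * ∑ᵥ S F ≡ ∑ᵥ S (λ c → k * F c)
  *-distribˡ-∑ᵥ []            k F = refl
  *-distribˡ-∑ᵥ (inside ∷ S)  k F = trans (*-distribˡ-∑ℕ {q} k _) (∑ℕ-cong {q} λ t → *-distribˡ-∑ᵥ S k _)
  *-distribˡ-∑ᵥ (outside ∷ S) k F = *-distribˡ-∑ᵥ S k _

  ∑ᵥ-const : ∀ {m} (S : Subset m) k → ∑ᵥ S (λ _ → k) ≡ q ^ ∣ S ∣ * k
  ∑ᵥ-const []            k = sym (ℕₚ.+-identityʳ k)
  ∑ᵥ-const (inside ∷ S)  k = begin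
    ∑ℕ {q} (λ _ → ∑ᵥ S (λ _ → k)) ≡⟨ ∑ℕ-cong {q} (λ _ → ∑ᵥ-const S k) ⟩
    ∑ℕ {q} (λ _ → q ^ ∣ S ∣ * k)  ≡⟨ ∑ℕ-const {q} (q ^ ∣ S ∣ * k) ⟩
    q * (q ^ ∣ S ∣ * k)           ≡⟨ ℕₚ.*-assoc q _ k ⟨
    q ^ ∣ inside ∷ S ∣ * k        ∎
    where open ≡-Reasoning
  ∑ᵥ-const (outside ∷ S) k = ∑ᵥ-const S k

  ∑ᵥ-∑ℕ-comm : ∀ {m l} (S : Subset m) (F : (Fin m → K) → Fin l → ℕ) →
    ∑ᵥ S (λ c → ∑ℕ (F c)) ≡ ∑ℕ (λ i → ∑ᵥ S (λ c → F c i))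
  ∑ᵥ-∑ℕ-comm {l = zero}  S F = trans (∑ᵥ-const S 0) (ℕₚ.*-zeroʳ (q ^ ∣ S ∣))
  ∑ᵥ-∑ℕ-comm {l = suc l} S F =
    trans (∑ᵥ-distrib-+ S _ _) (cong (∑ᵥ S (λ c → F c zero) +_) (∑ᵥ-∑ℕ-comm S (λ c → F c ∘ suc)))

  ∑ℕ-𝟙-unique-element : ∀ {P : K → Set} (P? : ∀ x → Dec (P x)) y →
    (∀ x → P x → x ≈ y) → (∀ x → x ≈ y → P x) → ∑ℕ {q} (λ t → 𝟙 (P? (fromFin t))) ≡ 1
  ∑ℕ-𝟙-unique-element P? y P⇒≈y ≈y⇒P = ∑ℕ-𝟙-unique (P? ∘ fromFin) (toFin y)
    (≈y⇒P _ (from-to y)) (λ t Pt → trans (sym (to-from t)) (toFin-cong (P⇒≈y _ Pt)))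

  zero-indicator : ∀ {m} → (Fin m → K) → ℕ
  zero-indicator {zero}  c = 1
  zero-indicator {suc m} c = 𝟙 (c zero ≈? 0#) * zero-indicator (c ∘ suc)

  zero-indicator≡1⊎nonzero : ∀ {m} (c : Fin m → K) → zero-indicator c ≡ 1 ⊎ ∃ λ h → c h ≉ 0#
  zero-indicator≡1⊎nonzero {zero}  c = inj₁ refl
  zero-indicator≡1⊎nonzero {suc m} c with c zero ≈? 0# | zero-indicator≡1⊎nonzero (c ∘ suc)
  ... | yes _  | inj₁ eq       = inj₁ (trans (ℕₚ.+-identityʳ _) eq)
  ... | yes _  | inj₂ (h , ch) = inj₂ (suc h , ch)
  ... | no c₀  | _             = inj₂ (zero , c₀)

  ∑ᵥ-zero-indicator : ∀ {m} (S : Subset m) → ∑ᵥ S zero-indicator ≡ 1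
  ∑ᵥ-zero-indicator []            = refl
  ∑ᵥ-zero-indicator (inside ∷ S)  = begin
    ∑ℕ {q} (λ t → ∑ᵥ S (λ c → t≈0 t * zero-indicator c))
      ≡⟨ ∑ℕ-cong {q} (λ t → *-distribˡ-∑ᵥ S (t≈0 t) zero-indicator) ⟨
    ∑ℕ {q} (λ t → t≈0 t * ∑ᵥ S zero-indicator)
      ≡⟨ ∑ℕ-cong {q} (λ t → trans (cong (t≈0 t *_) (∑ᵥ-zero-indicator S)) (ℕₚ.*-identityʳ (t≈0 t))) ⟩
    ∑ℕ {q} t≈0
      ≡⟨ ∑ℕ-𝟙-unique-element (_≈? 0#) 0# (λ _ → id) (λ _ → id) ⟩
    1 ∎
    where
    open ≡-Reasoning
    t≈0 : Fin q → ℕ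
    t≈0 t = 𝟙 (fromFin t ≈? 0#)
  ∑ᵥ-zero-indicator (outside ∷ S) = begin
    ∑ᵥ S (λ c → 𝟙 (0# ≈? 0#) * zero-indicator c)
      ≡⟨ *-distribˡ-∑ᵥ S (𝟙 (0# ≈? 0#)) zero-indicator ⟨
    𝟙 (0# ≈? 0#) * ∑ᵥ S zero-indicator
      ≡⟨ cong₂ _*_ (𝟙-yes (0# ≈? 0#) ≈-refl) (∑ᵥ-zero-indicator S) ⟩
    1 ∎
    where open ≡-Reasoning

  dot : ∀ {m} → (Fin m → K) → (Fin m → K) → K
  dot c a = sum (λ i → c i ⊙ a i)

  dot-orthogonal : ∀ {m} {S : Subset m} {a c : Fin m → K} →
    (∀ h → h ∈ S → a h ≈ 0#) → Supported S c → dot c a ≈ 0#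
  dot-orthogonal {S = S} {a} {c} a≈0 c≈0 = sum-zero term≈0
    where
    term≈0 : ∀ h → c h ⊙ a h ≈ 0#
    term≈0 h with h ∈? S
    ... | yes h∈ = ≈-trans (*-congˡ (a≈0 h h∈)) (zeroʳ (c h))
    ... | no  h∉ = ≈-trans (*-congʳ (c≈0 h h∉)) (zeroˡ (a h))

  x+y≈z⇒y≈-x+z : ∀ {x y z} → x ⊕ y ≈ z → y ≈ ⊖ x ⊕ z
  x+y≈z⇒y≈-x+z {x} {y} eq = ≈-trans (≈-sym (\\-leftDividesʳ x y)) (+-congˡ eq)

  y≈-x+z⇒x+y≈z : ∀ {x y z} → y ≈ ⊖ x ⊕ z → x ⊕ y ≈ z
  y≈-x+z⇒x+y≈z {x} {z = z} eq = ≈-trans (+-congˡ eq) (\\-leftDividesˡ x z)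

  𝟙-≈-congˡ : ∀ {a b} x → a ≈ b → 𝟙 (a ≈? x) ≡ 𝟙 (b ≈? x)
  𝟙-≈-congˡ x a≈b = 𝟙-cong (≈-trans (≈-sym a≈b)) (≈-trans a≈b) _ _

  ∑ℕ-𝟙-linear-equation : ∀ {a} x → a ≉ 0# → ∑ℕ {q} (λ t → 𝟙 (fromFin t ⊙ a ≈? x)) ≡ 1
  ∑ℕ-𝟙-linear-equation {a} x a≉0 with inverse a a≉0
  ... | a⁻¹ , aa⁻¹≈1 = ∑ℕ-𝟙-unique-element (λ t → t ⊙ a ≈? x) (x ⊙ a⁻¹) solve unsolve
    where
    open ≈-Reasoning
    solve : ∀ t → t ⊙ a ≈ x → t ≈ x ⊙ a⁻¹
    solve t ta≈x = begin
      t               ≈⟨ *-identityʳ t ⟨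
      t ⊙ 1#          ≈⟨ *-congˡ aa⁻¹≈1 ⟨
      t ⊙ (a ⊙ a⁻¹)   ≈⟨ *-assoc t a a⁻¹ ⟨
      (t ⊙ a) ⊙ a⁻¹   ≈⟨ *-congʳ ta≈x ⟩
      x ⊙ a⁻¹         ∎
    unsolve : ∀ t → t ≈ x ⊙ a⁻¹ → t ⊙ a ≈ x
    unsolve t t≈ = begin
      t ⊙ a           ≈⟨ *-congʳ t≈ ⟩
      (x ⊙ a⁻¹) ⊙ a   ≈⟨ *-assoc x a⁻¹ a ⟩
      x ⊙ (a⁻¹ ⊙ a)   ≈⟨ *-congˡ (≈-trans (*-comm a⁻¹ a) aa⁻¹≈1) ⟩
      x ⊙ 1#          ≈⟨ *-identityʳ x ⟩
      x               ∎

  solutions-count-∷inside : ∀ {m} (S : Subset m) (a : Fin (suc m) → K) →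
    (∀ y → q * ∑ᵥ S (λ c → 𝟙 (dot c (a ∘ suc) ≈? y)) ≡ q ^ ∣ S ∣) →
    ∀ x → q * ∑ᵥ (inside ∷ S) (λ c → 𝟙 (dot c a ≈? x)) ≡ q ^ ∣ inside ∷ S ∣
  solutions-count-∷inside S a solutions-tail x = begin
    q * ∑ℕ {q} (λ t → ∑ᵥ S (λ c → 𝟙 (t⊙a₀ t ⊕ dot c (a ∘ suc) ≈? x)))
      ≡⟨ *-distribˡ-∑ℕ {q} q _ ⟩
    ∑ℕ {q} (λ t → q * ∑ᵥ S (λ c → 𝟙 (t⊙a₀ t ⊕ dot c (a ∘ suc) ≈? x)))
      ≡⟨ ∑ℕ-cong {q} (λ t → trans
           (cong (q *_) (∑ᵥ-cong S λ c _ → 𝟙-cong x+y≈z⇒y≈-x+z y≈-x+z⇒x+y≈z _ _))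
           (solutions-tail (⊖ t⊙a₀ t ⊕ x))) ⟩
    ∑ℕ {q} (λ t → q ^ ∣ S ∣)
      ≡⟨ ∑ℕ-const {q} _ ⟩
    q * q ^ ∣ S ∣ ∎
    where
    open ≡-Reasoning
    t⊙a₀ : Fin q → K
    t⊙a₀ t = fromFin t ⊙ a zero

  solutions-count-∷inside-only : ∀ {m} (S : Subset m) (a : Fin (suc m) → K) → a zero ≉ 0# →
    (∀ h → h ∈ S → a (suc h) ≈ 0#) →
    ∀ x → q * ∑ᵥ (inside ∷ S) (λ c → 𝟙 (dot c a ≈? x)) ≡ q ^ ∣ inside ∷ S ∣
  solutions-count-∷inside-only S a a₀≉0 a≈0 x = cong (q *_) (begin
    ∑ℕ {q} (λ t → ∑ᵥ S (λ c → 𝟙 (t⊙a₀ t ⊕ dot c (a ∘ suc) ≈? x)))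
      ≡⟨ ∑ℕ-cong {q} (λ t → ∑ᵥ-cong S λ c c≈0 →
           𝟙-≈-congˡ x (≈-trans (+-congˡ (dot-orthogonal a≈0 c≈0)) (+-identityʳ (t⊙a₀ t)))) ⟩
    ∑ℕ {q} (λ t → ∑ᵥ S (λ _ → 𝟙 (t⊙a₀ t ≈? x)))
      ≡⟨ ∑ℕ-cong {q} (λ t → ∑ᵥ-const S _) ⟩
    ∑ℕ {q} (λ t → q ^ ∣ S ∣ * 𝟙 (t⊙a₀ t ≈? x))
      ≡⟨ *-distribˡ-∑ℕ {q} (q ^ ∣ S ∣) _ ⟨
    q ^ ∣ S ∣ * ∑ℕ {q} (λ t → 𝟙 (t⊙a₀ t ≈? x))
      ≡⟨ cong (q ^ ∣ S ∣ *_) (∑ℕ-𝟙-linear-equation x a₀≉0) ⟩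
    q ^ ∣ S ∣ * 1
      ≡⟨ ℕₚ.*-identityʳ _ ⟩
    q ^ ∣ S ∣ ∎)
    where
    open ≡-Reasoning
    t⊙a₀ : Fin q → K
    t⊙a₀ t = fromFin t ⊙ a zero

  solutions-count : ∀ {m} (S : Subset m) (a : Fin m → K) {h} → h ∈ S → a h ≉ 0# →
    ∀ x → q * ∑ᵥ S (λ c → 𝟙 (dot c a ≈? x)) ≡ q ^ ∣ S ∣
  solutions-count (inside ∷ S) a here a₀≉0 with any? (λ h → h ∈? S ×-dec ¬? (a (suc h) ≈? 0#))
  ... | yes (h , h∈ , aₕ≉0) = solutions-count-∷inside S a (solutions-count S (a ∘ suc) h∈ aₕ≉0)
  ... | no  ∄ = solutions-count-∷inside-only S a a₀≉0 λ h h∈ →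
    decidable-stable (a (suc h) ≈? 0#) λ aₕ≉0 → ∄ (h , h∈ , aₕ≉0)
  solutions-count (inside ∷ S)  a (there h∈) aₕ≉0 = solutions-count-∷inside S a (solutions-count S (a ∘ suc) h∈ aₕ≉0)
  solutions-count (outside ∷ S) a (there h∈) aₕ≉0 x = trans
    (cong (q *_) (∑ᵥ-cong S λ c _ →
      𝟙-≈-congˡ x (≈-trans (+-congʳ (zeroˡ (a zero))) (+-identityˡ (dot c (a ∘ suc))))))
    (solutions-count S (a ∘ suc) h∈ aₕ≉0 x)

  nonsolutions-count : ∀ {m} (S : Subset m) (a : Fin m → K) {h} → h ∈ S → a h ≉ 0# →
    q * ∑ᵥ S (λ c → 𝟙 (¬? (dot c a ≈? 0#))) + q ^ ∣ S ∣ ≡ q * q ^ ∣ S ∣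
  nonsolutions-count S a h∈ aₕ≉0 = begin
    q * ∑ᵥ S (λ c → 𝟙 (¬? (dot c a ≈? 0#))) + q ^ ∣ S ∣
      ≡⟨ cong (q * ∑ᵥ S (λ c → 𝟙 (¬? (dot c a ≈? 0#))) +_) (solutions-count S a h∈ aₕ≉0 0#) ⟨
    q * ∑ᵥ S (λ c → 𝟙 (¬? (dot c a ≈? 0#))) + q * ∑ᵥ S (λ c → 𝟙 (dot c a ≈? 0#))
      ≡⟨ ℕₚ.*-distribˡ-+ q _ _ ⟨
    q * (∑ᵥ S (λ c → 𝟙 (¬? (dot c a ≈? 0#))) + ∑ᵥ S (λ c → 𝟙 (dot c a ≈? 0#)))
      ≡⟨ cong (q *_) (∑ᵥ-distrib-+ S _ _) ⟨
    q * ∑ᵥ S (λ c → 𝟙 (¬? (dot c a ≈? 0#)) + 𝟙 (dot c a ≈? 0#))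
      ≡⟨ cong (q *_) (∑ᵥ-cong S λ c _ → 𝟙-¬ (dot c a ≈? 0#)) ⟩
    q * ∑ᵥ S (λ _ → 1)
      ≡⟨ cong (q *_) (trans (∑ᵥ-const S 1) (ℕₚ.*-identityʳ _)) ⟩
    q * q ^ ∣ S ∣ ∎
    where open ≡-Reasoning

  support : ∀ {m} → (Fin m → K) → Subset m
  support f = tabulate (λ g → does (¬? (f g ≈? 0#)))

  Supported-mono : ∀ {m} {X Y : Subset m} {c} → X ⊆ Y → Supported X c → Supported Y c
  Supported-mono X⊆Y c≈0 h h∉Y = c≈0 h (h∉Y ∘ X⊆Y)

  Supported-[]≔inside : ∀ {m} {X : Subset m} {g c} →
    Supported (X [ g ]≔ inside) c → c g ≈ 0# → Supported X c
  Supported-[]≔inside {X = X} {g} c≈0 cg≈0 h h∉X with h ≟ g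
  ... | yes refl = cg≈0
  ... | no  h≢g  = c≈0 h (h∉X ∘ ∈-[]≔⁻ X inside h≢g)

  Supported-axpy : ∀ {m} {S : Subset m} {a b} s → Supported S a → Supported S b →
    Supported S (λ h → a h ⊕ s ⊙ b h)
  Supported-axpy s a≈0 b≈0 h h∉ =
    ≈-trans (+-cong (a≈0 h h∉) (≈-trans (*-congˡ (b≈0 h h∉)) (zeroʳ s))) (+-identityˡ 0#)

  Supported-δ : ∀ {m} {S : Subset m} {g} → g ∈ S → Supported S (δ g)
  Supported-δ {g = g} g∈S h h∉S = δ-off {i = g} {h} λ { refl → h∉S g∈S }

  -- Matroids represented over the field

  module Representation {n k} (v : Fin n → Fin k → K) where

    IsRelation : (Fin n → K) → Set
    IsRelation c = ∀ j → sum (λ i → c i ⊙ v i j) ≈ 0#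

    Dependency : Subset n → Set
    Dependency X = ∃ λ c → Supported X c × IsRelation c × ∃ λ i → c i ≉ 0#

    ¬Indep⇒¬¬Dependency : ∀ {X} → ¬ Indep R v X → ¬ ¬ Dependency X
    ¬Indep⇒¬¬Dependency ¬indep ¬dependency = ¬indep λ c c≈0 relation i →
      decidable-stable (c i ≈? 0#) λ cᵢ≉0 → ¬dependency (c , c≈0 , relation , i , cᵢ≉0)

    IsRelation-axpy : ∀ {a b} s → IsRelation a → IsRelation b → IsRelation (λ h → a h ⊕ s ⊙ b h)
    IsRelation-axpy {a} {b} s a-rel b-rel j = begin
      sum (λ h → (a h ⊕ s ⊙ b h) ⊙ v h j)
        ≈⟨ ∑-axpy a b (λ h → v h j) s ⟩
      sum (λ h → a h ⊙ v h j) ⊕ s ⊙ sum (λ h → b h ⊙ v h j)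
        ≈⟨ +-cong (a-rel j) (≈-trans (*-congˡ (b-rel j)) (zeroʳ s)) ⟩
      0# ⊕ 0#
        ≈⟨ +-identityˡ 0# ⟩
      0# ∎
      where open ≈-Reasoning

    extension-coefficient≉0 : ∀ {X g c} → Indep R v X → Supported (X [ g ]≔ inside) c →
      IsRelation c → ∃ (λ i → c i ≉ 0#) → c g ≉ 0#
    extension-coefficient≉0 indep c≈0 relation (i , cᵢ≉0) cg≈0 =
      cᵢ≉0 (indep _ (Supported-[]≔inside c≈0 cg≈0) relation i)

    Simple⇒¬parallel : Simple R v → ∀ {e f} → f ≢ e → ∀ a → ¬ (∀ j → v f j ≈ a ⊙ v e j)
    Simple⇒¬parallel simple {e} {f} f≢e a vf≈avₑ = 1≉0 (begin
      1#                    ≈⟨ +-identityʳ 1# ⟨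
      1# ⊕ 0#               ≈⟨ +-congʳ (δ-diag f) ⟨
      δ f f ⊕ 0#            ≈⟨ +-congˡ (≈-trans (*-congˡ (δ-off f≢e)) (zeroʳ (⊖ a))) ⟨
      δ f f ⊕ ⊖ a ⊙ δ e f   ≈⟨ simple E₂ ∣E₂∣≤2 c c-supported c-relation f ⟩
      0#                    ∎)
      where
      open ≈-Reasoning
      E₂ = ⁅ e ⁆ [ f ]≔ inside
      ∣E₂∣≤2 : ∣ E₂ ∣ ≤ 2
      ∣E₂∣≤2 = ℕₚ.≤-trans (∣p[x]≔inside∣≤ ⁅ e ⁆ f) (s≤s (ℕₚ.≤-reflexive (∣⁅x⁆∣≡1 e)))
      c : Fin n → K
      c h = δ f h ⊕ ⊖ a ⊙ δ e h
      c-supported : Supported E₂ c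
      c-supported = Supported-axpy (⊖ a) (Supported-δ (x∈p[x]≔inside ⁅ e ⁆ f))
        (Supported-δ (∈-[]≔⁺ ⁅ e ⁆ inside (f≢e ∘ sym) (x∈⁅x⁆ e)))
      c-relation : IsRelation c
      c-relation j = begin
        sum (λ h → c h ⊙ v h j)
          ≈⟨ ∑-axpy (δ f) (δ e) (λ h → v h j) (⊖ a) ⟩
        sum (λ h → δ f h ⊙ v h j) ⊕ ⊖ a ⊙ sum (λ h → δ e h ⊙ v h j)
          ≈⟨ +-cong (∑-δ f _) (*-congˡ (∑-δ e _)) ⟩
        v f j ⊕ ⊖ a ⊙ v e j
          ≈⟨ +-cong (vf≈avₑ j) (≈-sym (-‿distribˡ-* a (v e j))) ⟩
        a ⊙ v e j ⊕ ⊖ (a ⊙ v e j)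
          ≈⟨ -‿inverseʳ (a ⊙ v e j) ⟩
        0# ∎

    Indep-maximum⇒maximal : ∀ {r B} → (∀ X → Indep R v X → ∣ X ∣ ≤ r) → ∣ B ∣ ≡ r →
      ∀ g → g ∉ B → ¬ Indep R v (B [ g ]≔ inside)
    Indep-maximum⇒maximal {r} {B} rank≤ ∣B∣≡r g g∉B indep′ = ℕₚ.1+n≰n (begin
      suc r                   ≡⟨ cong suc ∣B∣≡r ⟨
      suc ∣ B ∣               ≡⟨ ∣p[x]≔inside∣ B g g∉B ⟨
      ∣ B [ g ]≔ inside ∣     ≤⟨ rank≤ _ indep′ ⟩
      r                       ∎)
      where open ℕₚ.≤-Reasoning

    exchange : ∀ {X e x c} → Indep R v X → e ∉ X → x ∈ X →
      Supported (X [ e ]≔ inside) c → IsRelation c → c e ≉ 0# → c x ≉ 0# →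
      Indep R v (X [ x ]≔ outside [ e ]≔ inside)
    exchange {X} {e} {x} {c} indep e∉X x∈X c≈0 c-rel cₑ≉0 cₓ≉0 d d≈0 d-rel h = begin
      d h             ≈⟨ +-identityʳ (d h) ⟨
      d h ⊕ 0#        ≈⟨ +-congˡ (≈-trans (*-congʳ ⊖t≈0) (zeroˡ (c h))) ⟨
      d h ⊕ ⊖ t ⊙ c h ≈⟨ d′≈0 h ⟩
      0#              ∎
      where
      open ≈-Reasoning
      -- d′ = d - t c vanishes at e, so independence of X forces d′ = 0; then t = 0 from d′ x = - t c x.
      t : K
      t = d e ⊙ proj₁ (inverse (c e) cₑ≉0)
      t⊙cₑ≈dₑ : t ⊙ c e ≈ d e
      t⊙cₑ≈dₑ = ≈-trans (*-assoc (d e) _ (c e)) (≈-trans (*-congˡ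
        (≈-trans (*-comm _ (c e)) (proj₂ (inverse (c e) cₑ≉0)))) (*-identityʳ (d e)))
      d′ : Fin n → K
      d′ h = d h ⊕ ⊖ t ⊙ c h
      X-x+e⊆X+e : X [ x ]≔ outside [ e ]≔ inside ⊆ X [ e ]≔ inside
      X-x+e⊆X+e {y} y∈ with ∈-[]≔inside⁻ _ e y∈
      ... | inj₁ refl = x∈p[x]≔inside X e
      ... | inj₂ y∈X-x = p⊆p[x]≔inside X e (p[x]≔outside⊆p X x y∈X-x)
      d′≈0 : ∀ h → d′ h ≈ 0#
      d′≈0 = indep d′
        (Supported-[]≔inside (Supported-axpy (⊖ t) (Supported-mono X-x+e⊆X+e d≈0) c≈0)
          (≈-trans (+-congˡ (≈-trans (≈-sym (-‿distribˡ-* t (c e))) (-‿cong t⊙cₑ≈dₑ))) (-‿inverseʳ (d e))))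
        (IsRelation-axpy (⊖ t) d-rel c-rel)
      dₓ≈0 : d x ≈ 0#
      dₓ≈0 = d≈0 x λ x∈ → x∉p[x]≔outside X x
        (∈-[]≔⁻ _ inside (λ { refl → e∉X x∈X }) x∈)
      ⊖t≈0 : ⊖ t ≈ 0#
      ⊖t≈0 = x*y≈0∧y≉0⇒x≈0 (≈-trans (≈-sym (≈-trans (+-congʳ dₓ≈0) (+-identityˡ _))) (d′≈0 x)) cₓ≉0

    BasisThrough : ℕ → Fin n → Set
    BasisThrough r e = ∃ λ D → e ∉ D × suc ∣ D ∣ ≡ r × Indep R v (D [ e ]≔ inside)

    basis-through : ∀ {r} → Simple R v → (∀ X → Indep R v X → ∣ X ∣ ≤ r) →
      ∀ {X} → Indep R v X → ∣ X ∣ ≡ r → ∀ e → ¬ ¬ BasisThrough r e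
    basis-through {r} simple rank≤ {X} indep ∣X∣≡r e with e ∈? X
    ... | yes e∈X = pure {A = BasisThrough r e} (X [ e ]≔ outside , x∉p[x]≔outside X e ,
      trans (∣p[x]≔outside∣ X e e∈X) ∣X∣≡r , subst (Indep R v) (sym X-e+e≡X) indep)
      where
      X-e+e≡X : X [ e ]≔ outside [ e ]≔ inside ≡ X
      X-e+e≡X = trans (Vecₚ.[]≔-idempotent X e)
        (trans (cong (X [ e ]≔_) (sym (Vecₚ.[]=⇒lookup e∈X))) (Vecₚ.[]≔-lookup X e))
    ... | no  e∉X = ¬Indep⇒¬¬Dependency (Indep-maximum⇒maximal rank≤ ∣X∣≡r e e∉X) >>= exchange-into
      where
      exchange-into : Dependency (X [ e ]≔ inside) → ¬ ¬ BasisThrough r e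
      exchange-into (c , c≈0 , c-rel , nonzero) with any? (λ x → x ∈? X ×-dec ¬? (c x ≈? 0#))
      ... | yes (x , x∈X , cₓ≉0) = pure {A = BasisThrough r e} (X [ x ]≔ outside ,
        (λ e∈ → e∉X (p[x]≔outside⊆p X x e∈)) , trans (∣p[x]≔outside∣ X x x∈X) ∣X∣≡r ,
        exchange indep e∉X x∈X c≈0 c-rel cₑ≉0 cₓ≉0)
        where cₑ≉0 = extension-coefficient≉0 indep c≈0 c-rel nonzero
      ... | no  ∄ = contradiction (simple ⁅ e ⁆ ∣⁅e⁆∣≤2 c c-at-e c-rel e)
        (extension-coefficient≉0 indep c≈0 c-rel nonzero)
        where
        ∣⁅e⁆∣≤2 : ∣ ⁅ e ⁆ ∣ ≤ 2
        ∣⁅e⁆∣≤2 = ℕₚ.≤-trans (ℕₚ.≤-reflexive (∣⁅x⁆∣≡1 e)) (s≤s z≤n)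
        c-at-e : Supported ⁅ e ⁆ c
        c-at-e h h∉⁅e⁆ with h ∈? X
        ... | yes h∈X = decidable-stable (c h ≈? 0#) λ cₕ≉0 → ∄ (h , h∈X , cₕ≉0)
        ... | no  h∉X = c≈0 h (h∉X ∘ ∈-[]≔⁻ X inside (λ { refl → h∉⁅e⁆ (x∈⁅x⁆ e) }))

    Coordinates : Subset n → Fin n → (Fin n → K) → Set
    Coordinates B g a = Supported B a × (∀ j → v g j ≈ sum (λ h → a h ⊙ v h j))

    coordinates : ∀ {B} → Indep R v B → (∀ g → g ∉ B → ¬ Indep R v (B [ g ]≔ inside)) →
      ∀ g → ¬ ¬ ∃ (Coordinates B g)
    coordinates {B} indep maximal g with g ∈? B
    ... | yes g∈B = pure {A = ∃ (Coordinates B g)} (δ g , Supported-δ g∈B , λ j → ≈-sym (∑-δ g _))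
    ... | no  g∉B = ¬Indep⇒¬¬Dependency (maximal g g∉B) >>= λ dependency →
      pure {A = ∃ (Coordinates B g)} (solve dependency)
      where
      solve : Dependency (B [ g ]≔ inside) → ∃ (Coordinates B g)
      solve (c , c≈0 , c-rel , nonzero) = a , a-supported , a-represents
        where
        open ≈-Reasoning
        cg⁻¹ : K
        cg⁻¹ = proj₁ (inverse (c g) (extension-coefficient≉0 indep c≈0 c-rel nonzero))
        a : Fin n → K
        a h = δ g h ⊕ ⊖ cg⁻¹ ⊙ c h
        a-supported : Supported B a
        a-supported = Supported-[]≔inside
          (Supported-axpy (⊖ cg⁻¹) (Supported-δ (x∈p[x]≔inside B g)) c≈0) (begin
            δ g g ⊕ ⊖ cg⁻¹ ⊙ c g   ≈⟨ +-cong (δ-diag g) (≈-sym (-‿distribˡ-* cg⁻¹ (c g))) ⟩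
            1# ⊕ ⊖ (cg⁻¹ ⊙ c g)    ≈⟨ +-congˡ (-‿cong (≈-trans (*-comm cg⁻¹ (c g))
                                        (proj₂ (inverse (c g) _)))) ⟩
            1# ⊕ ⊖ 1#              ≈⟨ -‿inverseʳ 1# ⟩
            0#                     ∎)
        a-represents : ∀ j → v g j ≈ sum (λ h → a h ⊙ v h j)
        a-represents j = ≈-sym (begin
          sum (λ h → a h ⊙ v h j)
            ≈⟨ ∑-axpy (δ g) c (λ h → v h j) (⊖ cg⁻¹) ⟩
          sum (λ h → δ g h ⊙ v h j) ⊕ ⊖ cg⁻¹ ⊙ sum (λ h → c h ⊙ v h j)
            ≈⟨ +-cong (∑-δ g _) (*-congˡ (c-rel j)) ⟩
          v g j ⊕ ⊖ cg⁻¹ ⊙ 0#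
            ≈⟨ +-congˡ (zeroʳ (⊖ cg⁻¹)) ⟩
          v g j ⊕ 0#
            ≈⟨ +-identityʳ (v g j) ⟩
          v g j ∎)

    Coordinates-basis-element : ∀ {B g a} → Indep R v B → g ∈ B → Coordinates B g a →
      ∀ h → a h ≈ δ g h
    Coordinates-basis-element {B} {g} {a} indep g∈B (a≈0 , a-represents) h =
      x∙y⁻¹≈ε⇒x≈y (a h) (δ g h) (≈-trans (+-congˡ (≈-sym (-1*x≈-x (δ g h))))
        (indep (λ h → a h ⊕ ⊖ 1# ⊙ δ g h) (Supported-axpy (⊖ 1#) a≈0 (Supported-δ g∈B)) relation h))
      where
      open ≈-Reasoning
      relation : IsRelation (λ h → a h ⊕ ⊖ 1# ⊙ δ g h)
      relation j = begin
        sum (λ h → (a h ⊕ ⊖ 1# ⊙ δ g h) ⊙ v h j)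
          ≈⟨ ∑-axpy a (δ g) (λ h → v h j) (⊖ 1#) ⟩
        sum (λ h → a h ⊙ v h j) ⊕ ⊖ 1# ⊙ sum (λ h → δ g h ⊙ v h j)
          ≈⟨ +-cong (a-represents j) (*-congˡ (≈-sym (∑-δ g (λ h → v h j)))) ⟨
        v g j ⊕ ⊖ 1# ⊙ v g j
          ≈⟨ +-congˡ (-1*x≈-x (v g j)) ⟩
        v g j ⊕ ⊖ v g j
          ≈⟨ -‿inverseʳ (v g j) ⟩
        0# ∎

    RespectsRelations : (Fin n → K) → Set
    RespectsRelations ψ = ∀ d → IsRelation d → sum (λ g → d g ⊙ ψ g) ≈ 0#

    vanishing-on-basis : ∀ {B} → IsBasis R v B → ∀ {ψ} → RespectsRelations ψ →
      (∀ g → g ∈ B → ψ g ≈ 0#) → ∀ g → ψ g ≈ 0#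
    vanishing-on-basis {B} (indep , maximal) {ψ} ψ-respects ψ≈0 g with g ∈? B
    ... | yes g∈B = ψ≈0 g g∈B
    ... | no  g∉B = decidable-stable (ψ g ≈? 0#) λ ψg≉0 →
      ¬Indep⇒¬¬Dependency B+g-dependent λ (d , d≈0 , d-rel , nonzero) →
        x≉0∧y≉0⇒x*y≉0 (extension-coefficient≉0 indep d≈0 d-rel nonzero) ψg≉0
          (≈-trans (≈-sym (sum-concentrated g (other-terms≈0 d≈0))) (ψ-respects d d-rel))
      where
      B+g-dependent : ¬ Indep R v (B [ g ]≔ inside)
      B+g-dependent indep′ =
        g∉B (subst (g ∈_) (maximal _ (p⊆p[x]≔inside B g) indep′) (x∈p[x]≔inside B g))
      other-terms≈0 : ∀ {d} → Supported (B [ g ]≔ inside) d → ∀ h → h ≢ g → d h ⊙ ψ h ≈ 0#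
      other-terms≈0 {d} d≈0 h h≢g with h ∈? B
      ... | yes h∈B = ≈-trans (*-congˡ (ψ≈0 h h∈B)) (zeroʳ (d h))
      ... | no  h∉B = ≈-trans (*-congʳ (d≈0 h (h∉B ∘ ∈-[]≔⁻ B inside h≢g))) (zeroˡ (ψ h))

    module CoordinateFunctionals {B} (B-indep : Indep R v B)
      (A : Fin n → Fin n → K) (A-coordinates : ∀ g → Coordinates B g (A g)) where

      φ : (Fin n → K) → Fin n → K
      φ c g = dot c (A g)

      φ-on-basis : ∀ c {g} → g ∈ B → φ c g ≈ c g
      φ-on-basis c {g} g∈B = begin
        sum (λ h → c h ⊙ A g h)   ≈⟨ sum-cong-≋ (λ h → ≈-trans (*-comm (c h) _)
                                       (*-congʳ (Coordinates-basis-element B-indep g∈B (A-coordinates g) h))) ⟩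
        sum (λ h → δ g h ⊙ c h)   ≈⟨ ∑-δ g c ⟩
        c g                       ∎
        where open ≈-Reasoning

      φ-respects-relations : ∀ c → RespectsRelations (φ c)
      φ-respects-relations c d d-rel = begin
        sum (λ g → d g ⊙ sum (λ h → c h ⊙ A g h))
          ≈⟨ sum-cong-≋ {n} (λ g → *-congˡ (sum-cong-≋ {n} λ h → *-comm (c h) (A g h))) ⟩
        sum (λ g → d g ⊙ sum (λ h → A g h ⊙ c h))
          ≈⟨ ∑∑-assoc d A c ⟨
        sum (λ h → E h ⊙ c h)
          ≈⟨ sum-zero (λ h → ≈-trans (*-congʳ (E≈0 h)) (zeroˡ (c h))) ⟩
        0# ∎
        where
        open ≈-Reasoning
        -- E = Σ_g d_g A_g represents Σ_g d_g v_g = 0 in the basis B, so E = 0.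
        E : Fin n → K
        E h = sum (λ g → d g ⊙ A g h)
        E≈0 : ∀ h → E h ≈ 0#
        E≈0 = B-indep E
          (λ h h∉B → sum-zero λ g → ≈-trans (*-congˡ (proj₁ (A-coordinates g) h h∉B)) (zeroʳ (d g)))
          (λ j → ≈-trans (∑∑-assoc d A (λ h → v h j))
            (≈-trans (sum-cong-≋ λ g → *-congˡ (≈-sym (proj₂ (A-coordinates g) j))) (d-rel j)))

      support-φ-meets-bases : ∀ c {h} → h ∈ B → c h ≉ 0# → MeetsAllBases R v (support (φ c))
      support-φ-meets-bases c {h} h∈B cₕ≉0 B′ B′-basis =
        decidable-stable (nonempty? (B′ ∩ support (φ c))) λ disjoint →
          cₕ≉0 (≈-trans (≈-sym (φ-on-basis c h∈B))
            (vanishing-on-basis B′-basis (φ-respects-relations c) (φ≈0 disjoint) h))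
        where
        φ≈0 : ¬ Nonempty (B′ ∩ support (φ c)) → ∀ g → g ∈ B′ → φ c g ≈ 0#
        φ≈0 disjoint g g∈B′ = decidable-stable (φ c g ≈? 0#) λ φ≉0 →
          disjoint (g , x∈p∩q⁺ (g∈B′ , ∈-tabulate⁺ _ (dec-true (¬? (φ c g ≈? 0#)) φ≉0)))

      A-not-concentrated : Simple R v → ∀ {e f} → f ≢ e → ¬ (∀ h → h ≢ e → A f h ≈ 0#)
      A-not-concentrated simple {e} {f} f≢e A≈0 = Simple⇒¬parallel simple f≢e (A f e) λ j →
        ≈-trans (proj₂ (A-coordinates f) j)
          (sum-concentrated e λ h h≢e → ≈-trans (*-congʳ (A≈0 h h≢e)) (zeroˡ (v h j)))

    module DoubleCounting (w : Fin n → ℕ) {D e} (e∉D : e ∉ D)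
      (B-indep : Indep R v (D [ e ]≔ inside))
      (A : Fin n → Fin n → K) (A-coordinates : ∀ g → Coordinates (D [ e ]≔ inside) g (A g)) where

      open CoordinateFunctionals B-indep A A-coordinates

      total : ℕ
      total = ∑ᵥ D (λ c → wt w (support (φ c)))

      occurrences : Fin n → ℕ
      occurrences g = ∑ᵥ D (λ c → 𝟙 (¬? (φ c g ≈? 0#)))

      q*total : q * total ≡ ∑ℕ (λ g → w g * (q * occurrences g))
      q*total = begin
        q * ∑ᵥ D (λ c → wt w (support (φ c)))
          ≡⟨ cong (q *_) (∑ᵥ-cong D λ c _ → wt-tabulate w (λ g → ¬? (φ c g ≈? 0#))) ⟩
        q * ∑ᵥ D (λ c → ∑ℕ (λ g → w g * 𝟙 (¬? (φ c g ≈? 0#))))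
          ≡⟨ cong (q *_) (∑ᵥ-∑ℕ-comm {l = n} D _) ⟩
        q * ∑ℕ (λ g → ∑ᵥ D (λ c → w g * 𝟙 (¬? (φ c g ≈? 0#))))
          ≡⟨ cong (q *_) (∑ℕ-cong {n} λ g → *-distribˡ-∑ᵥ D (w g) _) ⟨
        q * ∑ℕ (λ g → w g * occurrences g)
          ≡⟨ *-distribˡ-∑ℕ {n} q _ ⟩
        ∑ℕ (λ g → q * (w g * occurrences g))
          ≡⟨ ∑ℕ-cong {n} (λ g → x∙yz≈y∙xz q (w g) (occurrences g)) ⟩
        ∑ℕ (λ g → w g * (q * occurrences g)) ∎
        where open ≡-Reasoning

      occurrences-e : q * occurrences e ≡ 0
      occurrences-e = begin
        q * occurrences e            ≡⟨ cong (q *_) (∑ᵥ-cong D λ c c≈0 → 𝟙-no (¬? (φ c e ≈? 0#))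
                                          λ φ≉0 → φ≉0 (≈-trans (φ-on-basis c (x∈p[x]≔inside D e)) (c≈0 e e∉D))) ⟩
        q * ∑ᵥ D (λ _ → 0)           ≡⟨ cong (q *_) (∑ᵥ-const D 0) ⟩
        q * (q ^ ∣ D ∣ * 0)          ≡⟨ cong (q *_) (ℕₚ.*-zeroʳ (q ^ ∣ D ∣)) ⟩
        q * 0                        ≡⟨ ℕₚ.*-zeroʳ q ⟩
        0                            ∎
        where open ≡-Reasoning

      occurrences-off-e : Simple R v → ∀ g → g ≢ e → q * occurrences g ≡ (q ∸ 1) * q ^ ∣ D ∣
      occurrences-off-e simple g g≢e with any? (λ h → h ∈? D ×-dec ¬? (A g h ≈? 0#))
      ... | yes (h , h∈D , A≉0) = begin
        q * occurrences g
          ≡⟨ ℕₚ.m+n∸n≡m _ (q ^ ∣ D ∣) ⟨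
        q * occurrences g + q ^ ∣ D ∣ ∸ q ^ ∣ D ∣
          ≡⟨ cong (_∸ q ^ ∣ D ∣) (nonsolutions-count D (A g) h∈D A≉0) ⟩
        q * q ^ ∣ D ∣ ∸ q ^ ∣ D ∣
          ≡⟨ cong (q * q ^ ∣ D ∣ ∸_) (ℕₚ.*-identityˡ (q ^ ∣ D ∣)) ⟨
        q * q ^ ∣ D ∣ ∸ 1 * q ^ ∣ D ∣
          ≡⟨ ℕₚ.*-distribʳ-∸ (q ^ ∣ D ∣) q 1 ⟨
        (q ∸ 1) * q ^ ∣ D ∣ ∎
        where open ≡-Reasoning
      ... | no  ∄ = contradiction A≈0 (A-not-concentrated simple g≢e)
        where
        A≈0 : ∀ h → h ≢ e → A g h ≈ 0#
        A≈0 h h≢e with h ∈? D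
        ... | yes h∈D = decidable-stable (A g h ≈? 0#) λ A≉0 → ∄ (h , h∈D , A≉0)
        ... | no  h∉D = proj₁ (A-coordinates g) h (h∉D ∘ ∈-[]≔⁻ D inside h≢e)

      total-identity : Simple R v →
        q * total + (q ∸ 1) * q ^ ∣ D ∣ * w e ≡ (q ∸ 1) * q ^ ∣ D ∣ * ∑ℕ w
      total-identity simple = trans (cong (_+ _) q*total)
        (∑ℕ-*-except w (λ g → q * occurrences g) e _ occurrences-e (occurrences-off-e simple))

      total-lower-bound : ∀ {g₀} → (∀ C → IsCocircuit R v C → g₀ ≤ wt w C) →
        q ^ ∣ D ∣ * g₀ ≤ total + g₀
      total-lower-bound {g₀} g₀≤cocircuits = begin
        q ^ ∣ D ∣ * g₀
          ≡⟨ ∑ᵥ-const D g₀ ⟨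
        ∑ᵥ D (λ _ → g₀)
          ≤⟨ ∑ᵥ-mono D term-bound ⟩
        ∑ᵥ D (λ c → wt w (support (φ c)) + g₀ * zero-indicator c)
          ≡⟨ ∑ᵥ-distrib-+ D _ _ ⟩
        total + ∑ᵥ D (λ c → g₀ * zero-indicator c)
          ≡⟨ cong (total +_) (*-distribˡ-∑ᵥ D g₀ zero-indicator) ⟨
        total + g₀ * ∑ᵥ D zero-indicator
          ≡⟨ cong (λ x → total + g₀ * x) (∑ᵥ-zero-indicator D) ⟩
        total + g₀ * 1
          ≡⟨ cong (total +_) (ℕₚ.*-identityʳ g₀) ⟩
        total + g₀ ∎
        where
        open ℕₚ.≤-Reasoning
        term-bound : ∀ c → Supported D c → g₀ ≤ wt w (support (φ c)) + g₀ * zero-indicator c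
        term-bound c c≈0 with zero-indicator≡1⊎nonzero c
        ... | inj₁ c-is-zero = ℕₚ.≤-trans
          (ℕₚ.≤-reflexive (trans (sym (ℕₚ.*-identityʳ g₀)) (cong (g₀ *_) (sym c-is-zero)))) (ℕₚ.m≤n+m _ _)
        ... | inj₂ (h , cₕ≉0) = decidable-stable (g₀ ≤? _) (
          MeetsAllBases⇒¬¬CocircuitWithin (support-φ-meets-bases c h∈B cₕ≉0) >>= λ (C , C-cocircuit , C⊆) →
          pure {A = g₀ ≤ _} (ℕₚ.≤-trans (g₀≤cocircuits C C-cocircuit)
            (ℕₚ.≤-trans (wt-mono w C⊆) (ℕₚ.m≤m+n _ _))))
          where
          h∈B : h ∈ D [ e ]≔ inside
          h∈B = p⊆p[x]≔inside D e (decidable-stable (h ∈? D) λ h∉D → cₕ≉0 (c≈0 h h∉D))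
          open Cocircuits {R = R} v

weight-bound-arithmetic : ∀ p {Q W wₑ T g₀} →
  suc (suc p) * T + suc p * Q * wₑ ≡ suc p * Q * W →
  Q * g₀ ≤ T + g₀ →
  suc (suc p) * g₀ ≡ suc p * W →
  Q * wₑ ≤ W
weight-bound-arithmetic p {Q} {W} {wₑ} {T} {g₀} counted Qg₀≤T+g₀ qg₀≡p₁W =
  ℕₚ.*-cancelˡ-≤ p₁ (ℕₚ.+-cancelˡ-≤ (p₁ * Q * W) _ _ (begin
    p₁ * Q * W + p₁ * (Q * wₑ)    ≡⟨ cong (p₁ * Q * W +_) (ℕₚ.*-assoc p₁ Q wₑ) ⟨
    p₁ * Q * W + p₁ * Q * wₑ      ≤⟨ ℕₚ.+-monoˡ-≤ (p₁ * Q * wₑ) p₁QW≤qT+p₁W ⟩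
    q * T + p₁ * W + p₁ * Q * wₑ  ≡⟨ x+y+z≡x+z+y (q * T) (p₁ * W) (p₁ * Q * wₑ) ⟩
    q * T + p₁ * Q * wₑ + p₁ * W  ≡⟨ cong (_+ p₁ * W) counted ⟩
    p₁ * Q * W + p₁ * W           ∎))
  where
  open ℕₚ.≤-Reasoning
  p₁ = suc p
  q  = suc p₁
  p₁QW≤qT+p₁W : p₁ * Q * W ≤ q * T + p₁ * W
  p₁QW≤qT+p₁W = begin
    p₁ * Q * W      ≡⟨ xy∙z≈y∙xz p₁ Q W ⟩
    Q * (p₁ * W)    ≡⟨ cong (Q *_) qg₀≡p₁W ⟨
    Q * (q * g₀)    ≡⟨ x∙yz≈y∙xz Q q g₀ ⟩
    q * (Q * g₀)    ≤⟨ ℕₚ.*-monoʳ-≤ q Qg₀≤T+g₀ ⟩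
    q * (T + g₀)    ≡⟨ ℕₚ.*-distribˡ-+ q T g₀ ⟩
    q * T + q * g₀  ≡⟨ cong (q * T +_) qg₀≡p₁W ⟩
    q * T + p₁ * W  ∎

proposition3p3 : (q : ℕ) → IsPrimePower q →
    (R : CommutativeRing 0ℓ 0ℓ) → IsFiniteField R q →
    (n k r : ℕ) (v : Fin n → Fin k → CommutativeRing.Carrier R) →
    Simple R v → HasRank R v r →
    (w : Fin n → ℕ) → (∀ e → 1 ≤ w e) →
    ¬ IsoToPG R v r →
    (∃ λ C → IsCocircuit R v C × (∀ C′ → IsCocircuit R v C′ → wt w C ≤ wt w C′) ×
      q * wt w C ≡ (q ∸ 1) * wt w ⊤) →
    ∀ e → q ^ (r ∸ 1) * w e ≤ wt w ⊤
proposition3p3 q _ R F n k r v simple ((X , X-indep , ∣X∣≡r) , rank≤) w _ _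
  (C , _ , C-minimum , qC≡) e with field-size-2+ F
... | p , refl = decidable-stable (_ ≤? _) do
  (D , e∉D , 1+∣D∣≡r , B-indep) ← basis-through simple rank≤ X-indep ∣X∣≡r e
  coordinates-of ← ¬¬-pull-Fin (coordinates B-indep
    (Indep-maximum⇒maximal rank≤ (trans (∣p[x]≔inside∣ D e e∉D) 1+∣D∣≡r)))
  let open DoubleCounting w e∉D B-indep (proj₁ ∘ coordinates-of) (proj₂ ∘ coordinates-of)
  pure (subst (λ d → q ^ d * w e ≤ wt w ⊤) (cong (_∸ 1) 1+∣D∣≡r)
    (weight-bound-arithmetic p {q ^ ∣ D ∣} {wt w ⊤} {w e} {total} {wt w C}
      (trans (total-identity simple) (cong (suc p * q ^ ∣ D ∣ *_) (sym (wt-⊤ w))))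
      (total-lower-bound C-minimum) qC≡))
  where
  open FiniteField F
  open Representation v
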